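{- There exists a total function $f:\omega\to\omega$ which is $\omega$-approximable from above but which, for every $n\in\omega$, is not $n$-approximable.
   Context: A total $f$ is $\omega$-approximable from above if $f(x)=\lim_s g(x,s)$ for a total computable $g$ with $g(x,s+1)\le g(x,s)$ for all $x,s$ and there is a total computable $h$ with $|\{s:g(x,s)\ne g(x,s+1)\}|\le h(x)$ for all $x$. It is $n$-approximable if $f(x)=\lim_s g(x,s)$ for some total computable $g$ with $|\{s:g(x,s)\ne g(x,s+1)\}|\le n$ for all $x$. -}

module Defs where

open import Data.Nat using (ℕ; zero; suc; _≤_; _<_)
open import Data.Fin using (Fin)
open import Data.Vec using (Vec; []; _∷_; lookup)
open import Data.List using (List; length)
open import Data.List.Relation.Unary.All using (All)
open import Data.List.Relation.Unary.Unique.Propositional using (Unique)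
open import Data.Product using (Σ; ∃; _×_)
open import Relation.Binary.PropositionalEquality using (_≡_; _≢_)

data PR : ℕ → Set where
  cz   : ∀ {k} → PR k
  sc   : PR 1
  proj : ∀ {k} → Fin k → PR k
  comp : ∀ {k m} → PR m → Vec (PR k) m → PR k
  prec : ∀ {k} → PR k → PR (suc (suc k)) → PR (suc k)
  mu   : ∀ {k} → PR (suc k) → PR k

mutual
  data Eval : ∀ {k} → PR k → Vec ℕ k → ℕ → Set where
    ev-cz   : ∀ {k} {xs : Vec ℕ k} → Eval cz xs 0
    ev-sc   : ∀ {x} → Eval sc (x ∷ []) (suc x)
    ev-proj : ∀ {k} {i : Fin k} {xs} → Eval (proj i) xs (lookup xs i)
    ev-comp : ∀ {k m} {f : PR m} {gs : Vec (PR k) m} {xs ys y} →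
              EvalAll gs xs ys → Eval f ys y → Eval (comp f gs) xs y
    ev-prec0 : ∀ {k} {b : PR k} {s : PR (suc (suc k))} {xs y} →
               Eval b xs y → Eval (prec b s) (zero ∷ xs) y
    ev-precS : ∀ {k} {b : PR k} {s : PR (suc (suc k))} {n xs y z} →
               Eval (prec b s) (n ∷ xs) y → Eval s (n ∷ y ∷ xs) z →
               Eval (prec b s) (suc n ∷ xs) z
    ev-mu   : ∀ {k} {f : PR (suc k)} {xs y} →
              Eval f (y ∷ xs) 0 →
              (∀ z → z < y → ∃ λ m → Eval f (z ∷ xs) (suc m)) →
              Eval (mu f) xs y

  data EvalAll : ∀ {k m} → Vec (PR k) m → Vec ℕ k → Vec ℕ m → Set where
    ev-[] : ∀ {k} {xs : Vec ℕ k} → EvalAll [] xs []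
    ev-∷  : ∀ {k m} {g : PR k} {gs : Vec (PR k) m} {xs y ys} →
            Eval g xs y → EvalAll gs xs ys → EvalAll (g ∷ gs) xs (y ∷ ys)

Computable₁ : (ℕ → ℕ) → Set
Computable₁ h = Σ (PR 1) λ c → ∀ x → Eval c (x ∷ []) (h x)

Computable₂ : (ℕ → ℕ → ℕ) → Set
Computable₂ g = Σ (PR 2) λ c → ∀ x s → Eval c (x ∷ s ∷ []) (g x s)

-- |{ s : g(x,s) ≠ g(x,s+1) }| ≤ n : every finite list of distinct
-- change stages has length ≤ n.
ChangesAtMost : (ℕ → ℕ → ℕ) → ℕ → ℕ → Set
ChangesAtMost g x n =
  (l : List ℕ) → Unique l → All (λ s → g x s ≢ g x (suc s)) l → length l ≤ n

Lim : (ℕ → ℕ → ℕ) → ℕ → ℕ → Set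
Lim g x v = ∃ λ s₀ → ∀ s → s₀ ≤ s → g x s ≡ v

OmegaApproxAboveWitness : (ℕ → ℕ → ℕ) → Set
OmegaApproxAboveWitness g =
  Computable₂ g ×
  (∀ x s → g x (suc s) ≤ g x s) ×
  (Σ (ℕ → ℕ) λ h → Computable₁ h × (∀ x → ChangesAtMost g x (h x)))

LimitIsNApprox : (ℕ → ℕ → ℕ) → ℕ → Set
LimitIsNApprox g n =
  Σ (ℕ → ℕ → ℕ) λ g' → Computable₂ g' × (∀ x → ChangesAtMost g' x n) ×
    (∀ x v → Lim g x v → Lim g' x v)

-- On input x = ⟨c, n⟩ the approximation diagonalises against the code c. It starts
-- with the guess n + 1 and runs c on ⟨x, 0⟩, ⟨x, 1⟩, … in a step-counted universal
-- machine, lowering the guess by one whenever c is seen to output exactly the current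
-- guess. Guesses only decrease, from at most x + 1. If c computed a function g with the
-- same limit w and at most n changes, then for w > 0 some later value read from g would
-- be w and push the guess below w; for w = 0 the n + 1 decrements force a change of
-- g(x, ·) between any two consecutive triggering inputs and a last one on the way to 0,
-- n + 1 changes in all. The universal machine is a stack machine on Cantor-coded
-- configurations with a primitive recursive step function, which makes the
-- approximation computable.

module Submission where

open import Data.Empty using (⊥; ⊥-elim)
open import Data.Fin using (Fin; zero; suc; toℕ; fromℕ<)
import Data.Fin.Properties as Fin
open import Data.List using (List; []; _∷_; length)
import Data.List as List
open import Data.List.Membership.Propositional.Properties using (∈-lookup)
open import Data.List.Relation.Unary.All as All using (All; []; _∷_)
open import Data.List.Relation.Unary.AllPairs using ([]; _∷_)
open import Data.List.Relation.Unary.Unique.Propositional using (Unique)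
open import Data.Nat
open import Data.Nat.Properties
open import Data.Product using (Σ; ∃; _×_; _,_; proj₁; proj₂)
open import Data.Sum using (_⊎_; inj₁; inj₂)
open import Data.Vec using (Vec; []; _∷_; lookup)
open import Relation.Binary using (tri<; tri≈; tri>)
open import Relation.Binary.Construct.Closure.ReflexiveTransitive using (Star; ε; _◅_; _◅◅_)
open import Relation.Binary.PropositionalEquality
open import Relation.Nullary using (¬_; yes; no; contradiction)

open import Defs

record ComputableFn (k : ℕ) : Set where
  constructor computableFn
  field
    fn   : Vec ℕ k → ℕ
    code : PR k
    eval : ∀ xs → Eval code xs (fn xs)
open ComputableFn

Computable₃ : (ℕ → ℕ → ℕ → ℕ) → Set
Computable₃ g = Σ (PR 3) λ c → ∀ x y z → Eval c (x ∷ y ∷ z ∷ []) (g x y z)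

app₁ : ∀ {k} {g : ℕ → ℕ} → Computable₁ g → ComputableFn k → ComputableFn k
app₁ {g = g} (c , ev) A =
  computableFn (λ xs → g (fn A xs)) (comp c (code A ∷ []))
    λ xs → ev-comp (ev-∷ (eval A xs) ev-[]) (ev _)

app₂ : ∀ {k} {g : ℕ → ℕ → ℕ} → Computable₂ g → ComputableFn k → ComputableFn k → ComputableFn k
app₂ {g = g} (c , ev) A B =
  computableFn (λ xs → g (fn A xs) (fn B xs)) (comp c (code A ∷ code B ∷ []))
    λ xs → ev-comp (ev-∷ (eval A xs) (ev-∷ (eval B xs) ev-[])) (ev _ _)

app₃ : ∀ {k} {g : ℕ → ℕ → ℕ → ℕ} → Computable₃ g →
       ComputableFn k → ComputableFn k → ComputableFn k → ComputableFn k
app₃ {g = g} (c , ev) A B C =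
  computableFn (λ xs → g (fn A xs) (fn B xs) (fn C xs)) (comp c (code A ∷ code B ∷ code C ∷ []))
    λ xs → ev-comp (ev-∷ (eval A xs) (ev-∷ (eval B xs) (ev-∷ (eval C xs) ev-[]))) (ev _ _ _)

var : ∀ {k} → Fin k → ComputableFn k
var i = computableFn (λ xs → lookup xs i) (proj i) λ _ → ev-proj

arg₀ : ∀ {k} → ComputableFn (suc k)
arg₀ = var zero

arg₁ : ∀ {k} → ComputableFn (2 + k)
arg₁ = var (suc zero)

arg₂ : ∀ {k} → ComputableFn (3 + k)
arg₂ = var (suc (suc zero))

arg₃ : ∀ {k} → ComputableFn (4 + k)
arg₃ = var (suc (suc (suc zero)))

suc-computable : Computable₁ suc
suc-computable = sc , λ _ → ev-sc

const : ∀ {k} → ℕ → ComputableFn k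
const zero    = computableFn (λ _ → 0) cz λ _ → ev-cz
const (suc n) = app₁ suc-computable (const n)

computable₁ : ∀ {g} (A : ComputableFn 1) → (∀ x → fn A (x ∷ []) ≡ g x) → Computable₁ g
computable₁ A eq = code A , λ x → subst (Eval (code A) _) (eq x) (eval A _)

computable₂ : ∀ {g} (A : ComputableFn 2) → (∀ x y → fn A (x ∷ y ∷ []) ≡ g x y) → Computable₂ g
computable₂ A eq = code A , λ x y → subst (Eval (code A) _) (eq x y) (eval A _)

computable₃ : ∀ {g} (A : ComputableFn 3) →
              (∀ x y z → fn A (x ∷ y ∷ z ∷ []) ≡ g x y z) → Computable₃ g
computable₃ A eq = code A , λ x y z → subst (Eval (code A) _) (eq x y z) (eval A _)

eval-prec : ∀ {k} (B : ComputableFn k) (S : ComputableFn (2 + k)) (g : ℕ → Vec ℕ k → ℕ) →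
            (∀ xs → g 0 xs ≡ fn B xs) → (∀ n xs → g (suc n) xs ≡ fn S (n ∷ g n xs ∷ xs)) →
            ∀ n xs → Eval (prec (code B) (code S)) (n ∷ xs) (g n xs)
eval-prec B S g base step zero    xs =
  ev-prec0 (subst (Eval (code B) xs) (sym (base xs)) (eval B xs))
eval-prec B S g base step (suc n) xs =
  ev-precS (eval-prec B S g base step n xs) (subst (Eval (code S) _) (sym (step n xs)) (eval S _))

recursion₁ : ∀ {g : ℕ → ℕ} (B : ComputableFn 0) (S : ComputableFn 2) →
             g 0 ≡ fn B [] → (∀ n → g (suc n) ≡ fn S (n ∷ g n ∷ [])) → Computable₁ g
recursion₁ {g} B S base step =
  prec (code B) (code S) , λ n → eval-prec B S (λ n _ → g n) (λ { [] → base }) (λ { n [] → step n }) n []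

recursion₂ : ∀ {g : ℕ → ℕ → ℕ} (B : ComputableFn 1) (S : ComputableFn 3) →
             (∀ y → g 0 y ≡ fn B (y ∷ [])) → (∀ n y → g (suc n) y ≡ fn S (n ∷ g n y ∷ y ∷ [])) →
             Computable₂ g
recursion₂ {g} B S base step =
  prec (code B) (code S) ,
  λ n y → eval-prec B S (λ { n (y ∷ []) → g n y })
                      (λ { (y ∷ []) → base y }) (λ { n (y ∷ []) → step n y }) n (y ∷ [])

+-computable : Computable₂ _+_
+-computable = recursion₂ arg₀ (app₁ suc-computable arg₁) (λ _ → refl) (λ _ _ → refl)

pred-computable : Computable₁ pred
pred-computable = recursion₁ (const 0) arg₀ refl (λ _ → refl)

∸-computable : Computable₂ _∸_
∸-computable = computable₂ (app₂ flipped arg₁ arg₀) (λ _ _ → refl)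
  where
  flipped : Computable₂ (λ n m → m ∸ n)
  flipped = recursion₂ arg₀ (app₁ pred-computable arg₁) (λ _ → refl) (λ n m → sym (pred[m∸n]≡m∸[1+n] m n))

∣-∣-computable : Computable₂ ∣_-_∣
∣-∣-computable =
  computable₂ (app₂ +-computable (app₂ ∸-computable arg₀ arg₁) (app₂ ∸-computable arg₁ arg₀)) m∸n+n∸m≡∣m-n∣
  where
  m∸n+n∸m≡∣m-n∣ : ∀ m n → (m ∸ n) + (n ∸ m) ≡ ∣ m - n ∣
  m∸n+n∸m≡∣m-n∣ zero    n       = cong (_+ n) (0∸n≡0 n)
  m∸n+n∸m≡∣m-n∣ (suc m) zero    = +-identityʳ (suc m)
  m∸n+n∸m≡∣m-n∣ (suc m) (suc n) = m∸n+n∸m≡∣m-n∣ m n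

ifZero : ℕ → ℕ → ℕ → ℕ
ifZero zero    a b = a
ifZero (suc _) a b = b

ifZero-computable : Computable₃ ifZero
ifZero-computable =
  prec (code arg₀) (code arg₃) ,
  λ n a b → eval-prec arg₀ arg₃ (λ { n (a ∷ b ∷ []) → ifZero n a b })
                      (λ { (a ∷ b ∷ []) → refl }) (λ { n (a ∷ b ∷ []) → refl }) n (a ∷ b ∷ [])

tri : ℕ → ℕ
tri zero    = 0
tri (suc n) = tri n + suc n

tri-computable : Computable₁ tri
tri-computable =
  recursion₁ (const 0) (app₂ +-computable arg₁ (app₁ suc-computable arg₀)) refl (λ _ → refl)

tri-mono-≤ : ∀ {a b} → a ≤ b → tri a ≤ tri b
tri-mono-≤ {zero}  _         = z≤n
tri-mono-≤ {suc a} (s≤s a≤b) = +-mono-≤ (tri-mono-≤ a≤b) (s≤s a≤b)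

triRoot : ℕ → ℕ
triRoot zero    = 0
triRoot (suc n) = let d = triRoot n in ifZero (tri (suc d) ∸ suc n) (suc d) d

triRoot-computable : Computable₁ triRoot
triRoot-computable =
  recursion₁ (const 0)
    (app₃ ifZero-computable
      (app₂ ∸-computable (app₁ tri-computable (app₁ suc-computable arg₁)) (app₁ suc-computable arg₀))
      (app₁ suc-computable arg₁) arg₁)
    refl (λ _ → refl)

TriRoot : ℕ → ℕ → Set
TriRoot d n = tri d ≤ n × n < tri (suc d)

triRoot-correct : ∀ n → TriRoot (triRoot n) n
triRoot-correct zero = z≤n , s≤s z≤n
triRoot-correct (suc n) with triRoot n | triRoot-correct n
... | d | lo , hi with tri (suc d) ∸ suc n in eq
...   | zero  = m∸n≡0⇒m≤n eq , <-≤-trans (m<m+n (suc n) z<s) (+-monoˡ-≤ (suc (suc d)) hi)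
...   | suc _ = m≤n⇒m≤1+n lo , m∸n≢0⇒n<m λ eq′ → 0≢1+n (trans (sym eq′) eq)

triRoot-unique : ∀ {a b n} → TriRoot a n → TriRoot b n → a ≡ b
triRoot-unique {a} {b} (lo₁ , hi₁) (lo₂ , hi₂) with <-cmp a b
... | tri< a<b _ _ = contradiction (<-≤-trans hi₁ (≤-trans (tri-mono-≤ a<b) lo₂)) (<-irrefl refl)
... | tri≈ _ a≡b _ = a≡b
... | tri> _ _ b<a = contradiction (<-≤-trans hi₂ (≤-trans (tri-mono-≤ b<a) lo₁)) (<-irrefl refl)

-- Only the equations proved in this block are ever used; keeping the pairing abstract
-- stops Agda from unfolding it inside the (large) step function of the machine.
abstract
  pair : ℕ → ℕ → ℕ
  pair a b = tri (a + b) + b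

  unpair₂ : ℕ → ℕ
  unpair₂ n = n ∸ tri (triRoot n)

  unpair₁ : ℕ → ℕ
  unpair₁ n = triRoot n ∸ unpair₂ n

  pair-computable : Computable₂ pair
  pair-computable =
    computable₂ (app₂ +-computable (app₁ tri-computable (app₂ +-computable arg₀ arg₁)) arg₁) (λ _ _ → refl)

  unpair₂-computable : Computable₁ unpair₂
  unpair₂-computable =
    computable₁ (app₂ ∸-computable arg₀ (app₁ tri-computable (app₁ triRoot-computable arg₀))) (λ _ → refl)

  unpair₁-computable : Computable₁ unpair₁
  unpair₁-computable =
    computable₁ (app₂ ∸-computable (app₁ triRoot-computable arg₀) (app₁ unpair₂-computable arg₀)) (λ _ → refl)

  triRoot-pair : ∀ a b → triRoot (pair a b) ≡ a + b
  triRoot-pair a b =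
    triRoot-unique (triRoot-correct (pair a b))
      (m≤m+n (tri (a + b)) b , +-monoʳ-< (tri (a + b)) (s≤s (m≤n+m b a)))

  unpair₂-pair : ∀ a b → unpair₂ (pair a b) ≡ b
  unpair₂-pair a b rewrite triRoot-pair a b = m+n∸m≡n (tri (a + b)) b

  unpair₁-pair : ∀ a b → unpair₁ (pair a b) ≡ a
  unpair₁-pair a b rewrite unpair₂-pair a b | triRoot-pair a b = m+n∸n≡m a b

  unpair₂-≤ : ∀ n → unpair₂ n ≤ n
  unpair₂-≤ n = m∸n≤m n (tri (triRoot n))

nthTail : ℕ → ℕ → ℕ
nthTail zero    l = l
nthTail (suc i) l = unpair₂ (pred (nthTail i l))

nth : ℕ → ℕ → ℕ
nth i l = unpair₁ (pred (nthTail i l))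

nthTail-computable : Computable₂ nthTail
nthTail-computable =
  recursion₂ arg₀ (app₁ unpair₂-computable (app₁ pred-computable arg₁)) (λ _ → refl) (λ _ _ → refl)

nth-computable : Computable₂ nth
nth-computable =
  computable₂ (app₁ unpair₁-computable (app₁ pred-computable (app₂ nthTail-computable arg₀ arg₁)))
    (λ _ _ → refl)

-- The machine is written once over this signature: read at ℕ it is the step function,
-- read at ComputableFn it is a code for it, so its computability holds by refl.
record Ops (A : Set) : Set where
  field
    numᵒ : ℕ → A
    sucᵒ predᵒ unpair₁ᵒ unpair₂ᵒ : A → A
    pairᵒ nthᵒ : A → A → A
    ifZeroᵒ : A → A → A → A

module Machine {A : Set} (O : Ops A) where
  open Ops O

  cons : A → A → A
  cons a l = sucᵒ (pairᵒ a l)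

  hd tl : A → A
  hd l = unpair₁ᵒ (predᵒ l)
  tl l = unpair₂ᵒ (predᵒ l)

  -- A configuration ⟨C , K⟩ pairs a control (evaluate a code or a list of codes on an
  -- argument list, or return a value) with a stack of frames coded as a list (0 = empty).
  -- Returning to the empty stack is a fixed point of step: the machine has halted.
  conf : A → A → A
  conf C K = pairᵒ C K

  evalᶜ evalAllᶜ : A → A → A
  evalᶜ    c  xs = pairᵒ (numᵒ 0) (pairᵒ c xs)
  evalAllᶜ gs xs = pairᵒ (numᵒ 1) (pairᵒ gs xs)

  returnᶜ : A → A
  returnᶜ v = pairᵒ (numᵒ 2) v

  composeᶠ prependᶠ : A → A
  composeᶠ f = pairᵒ (numᵒ 0) f
  prependᶠ y = pairᵒ (numᵒ 2) y

  restᶠ : A → A → A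
  restᶠ gs xs = pairᵒ (numᵒ 1) (pairᵒ gs xs)

  precᶠ muᶠ : A → A → A → A
  precᶠ s n xs = pairᵒ (numᵒ 3) (pairᵒ s (pairᵒ n xs))
  muᶠ f xs z   = pairᵒ (numᵒ 4) (pairᵒ f (pairᵒ xs z))

  muStep : A → A → A → A → A → A
  muStep f xs z v K =
    ifZeroᵒ v (conf (returnᶜ z) K)
              (conf (evalᶜ f (cons (sucᵒ z) xs)) (cons (muᶠ f xs (sucᵒ z)) K))

  popFrame : A → A → A → A → A
  popFrame tag p v K =
    ifZeroᵒ tag (conf (evalᶜ p v) K)
    (ifZeroᵒ (predᵒ tag) (conf (evalAllᶜ (unpair₁ᵒ p) (unpair₂ᵒ p)) (cons (prependᶠ v) K))
    (ifZeroᵒ (predᵒ (predᵒ tag)) (conf (returnᶜ (cons p v)) K)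
    (ifZeroᵒ (predᵒ (predᵒ (predᵒ tag)))
      (conf (evalᶜ (unpair₁ᵒ p) (cons (unpair₁ᵒ (unpair₂ᵒ p)) (cons v (unpair₂ᵒ (unpair₂ᵒ p))))) K)
      (muStep (unpair₁ᵒ p) (unpair₁ᵒ (unpair₂ᵒ p)) (unpair₂ᵒ (unpair₂ᵒ p)) v K))))

  returnStep : A → A → A
  returnStep v K = ifZeroᵒ K (conf (returnᶜ v) K) (popFrame (unpair₁ᵒ (hd K)) (unpair₂ᵒ (hd K)) v (tl K))

  evalAllStep : A → A → A → A
  evalAllStep gs xs K =
    ifZeroᵒ gs (conf (returnᶜ (numᵒ 0)) K)
               (conf (evalᶜ (hd gs) xs) (cons (restᶠ (tl gs) xs) K))

  precStep : A → A → A → A → A → A → A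
  precStep b s n xs c K =
    ifZeroᵒ n (conf (evalᶜ b xs) K)
              (conf (evalᶜ c (cons (predᵒ n) xs)) (cons (precᶠ s (predᵒ n) xs) K))

  codeStep : A → A → A → A → A → A
  codeStep tag p c xs K =
    ifZeroᵒ tag (conf (returnᶜ (numᵒ 0)) K)
    (ifZeroᵒ (predᵒ tag) (conf (returnᶜ (sucᵒ (hd xs))) K)
    (ifZeroᵒ (predᵒ (predᵒ tag)) (conf (returnᶜ (nthᵒ p xs)) K)
    (ifZeroᵒ (predᵒ (predᵒ (predᵒ tag))) (conf (evalAllᶜ (unpair₂ᵒ p) xs) (cons (composeᶠ (unpair₁ᵒ p)) K))
    (ifZeroᵒ (predᵒ (predᵒ (predᵒ (predᵒ tag)))) (precStep (unpair₁ᵒ p) (unpair₂ᵒ p) (hd xs) (tl xs) c K)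
      (conf (evalᶜ p (cons (numᵒ 0) xs)) (cons (muᶠ p xs (numᵒ 0)) K))))))

  controlStep : A → A → A → A
  controlStep tag p K =
    ifZeroᵒ tag (codeStep (unpair₁ᵒ (unpair₁ᵒ p)) (unpair₂ᵒ (unpair₁ᵒ p)) (unpair₁ᵒ p) (unpair₂ᵒ p) K)
    (ifZeroᵒ (predᵒ tag) (evalAllStep (unpair₁ᵒ p) (unpair₂ᵒ p) K)
    (returnStep p K))

  step : A → A
  step st = controlStep (unpair₁ᵒ (unpair₁ᵒ st)) (unpair₂ᵒ (unpair₁ᵒ st)) (unpair₂ᵒ st)

ℕ-ops : Ops ℕ
ℕ-ops = record
  { numᵒ = λ n → n ; sucᵒ = suc ; predᵒ = pred ; unpair₁ᵒ = unpair₁ ; unpair₂ᵒ = unpair₂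
  ; pairᵒ = pair ; nthᵒ = nth ; ifZeroᵒ = ifZero }

computable-ops : ∀ {k} → Ops (ComputableFn k)
computable-ops = record
  { numᵒ = const ; sucᵒ = app₁ suc-computable ; predᵒ = app₁ pred-computable
  ; unpair₁ᵒ = app₁ unpair₁-computable ; unpair₂ᵒ = app₁ unpair₂-computable
  ; pairᵒ = app₂ pair-computable ; nthᵒ = app₂ nth-computable ; ifZeroᵒ = app₃ ifZero-computable }

open Machine ℕ-ops public

step-computable : Computable₁ step
step-computable = computable₁ (Machine.step computable-ops arg₀) (λ _ → refl)

mutual
  encode : ∀ {k} → PR k → ℕ
  encode cz          = pair 0 0
  encode sc          = pair 1 0
  encode (proj i)    = pair 2 (toℕ i)
  encode (comp f gs) = pair 3 (pair (encode f) (encodeAll gs))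
  encode (prec b s)  = pair 4 (pair (encode b) (encode s))
  encode (mu f)      = pair 5 (encode f)

  encodeAll : ∀ {k m} → Vec (PR k) m → ℕ
  encodeAll []       = 0
  encodeAll (g ∷ gs) = cons (encode g) (encodeAll gs)

encodeArgs : ∀ {k} → Vec ℕ k → ℕ
encodeArgs []       = 0
encodeArgs (x ∷ xs) = cons x (encodeArgs xs)

hd-cons : ∀ a l → hd (cons a l) ≡ a
hd-cons = unpair₁-pair

tl-cons : ∀ a l → tl (cons a l) ≡ l
tl-cons = unpair₂-pair

nthTail-cons : ∀ i a l → nthTail (suc i) (cons a l) ≡ nthTail i l
nthTail-cons zero    a l = tl-cons a l
nthTail-cons (suc i) a l = cong (λ l′ → unpair₂ (pred l′)) (nthTail-cons i a l)

nth-encodeArgs : ∀ {k} (xs : Vec ℕ k) i → nth (toℕ i) (encodeArgs xs) ≡ lookup xs i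
nth-encodeArgs (x ∷ xs) zero    = hd-cons x (encodeArgs xs)
nth-encodeArgs (x ∷ xs) (suc i) =
  trans (cong (λ l → unpair₁ (pred l)) (nthTail-cons (toℕ i) x (encodeArgs xs))) (nth-encodeArgs xs i)

_↦_ : ℕ → ℕ → Set
a ↦ b = step a ≡ b

_↦*_ : ℕ → ℕ → Set
_↦*_ = Star _↦_

step-conf : ∀ C K → step (conf C K) ≡ controlStep (unpair₁ C) (unpair₂ C) K
step-conf C K rewrite unpair₁-pair C K | unpair₂-pair C K = refl

↦-eval : ∀ t p xs K → conf (evalᶜ (pair t p) xs) K ↦ codeStep t p (pair t p) xs K
↦-eval t p xs K
  rewrite step-conf (evalᶜ (pair t p) xs) K | unpair₁-pair 0 (pair (pair t p) xs)
        | unpair₂-pair 0 (pair (pair t p) xs) | unpair₁-pair (pair t p) xs | unpair₂-pair (pair t p) xs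
        | unpair₁-pair t p | unpair₂-pair t p = refl

↦-evalAll : ∀ gs xs K → conf (evalAllᶜ gs xs) K ↦ evalAllStep gs xs K
↦-evalAll gs xs K
  rewrite step-conf (evalAllᶜ gs xs) K | unpair₁-pair 1 (pair gs xs) | unpair₂-pair 1 (pair gs xs)
        | unpair₁-pair gs xs | unpair₂-pair gs xs = refl

↦-return : ∀ v t p K → conf (returnᶜ v) (cons (pair t p) K) ↦ popFrame t p v K
↦-return v t p K
  rewrite step-conf (returnᶜ v) (cons (pair t p) K) | unpair₁-pair 2 v | unpair₂-pair 2 v
        | hd-cons (pair t p) K | tl-cons (pair t p) K | unpair₁-pair t p | unpair₂-pair t p = refl

halted : ∀ v → conf (returnᶜ v) 0 ↦ conf (returnᶜ v) 0
halted v rewrite step-conf (returnᶜ v) 0 | unpair₁-pair 2 v | unpair₂-pair 2 v = refl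

↦-resume-compose : ∀ f v K → conf (returnᶜ v) (cons (composeᶠ f) K) ↦ conf (evalᶜ f v) K
↦-resume-compose f v K = ↦-return v 0 f K

↦-resume-rest : ∀ gs xs v K →
                conf (returnᶜ v) (cons (restᶠ gs xs) K) ↦ conf (evalAllᶜ gs xs) (cons (prependᶠ v) K)
↦-resume-rest gs xs v K rewrite ↦-return v 1 (pair gs xs) K | unpair₁-pair gs xs | unpair₂-pair gs xs = refl

↦-resume-prepend : ∀ y v K → conf (returnᶜ v) (cons (prependᶠ y) K) ↦ conf (returnᶜ (cons y v)) K
↦-resume-prepend y v K = ↦-return v 2 y K

↦-resume-prec : ∀ s n xs v K → conf (returnᶜ v) (cons (precᶠ s n xs) K) ↦ conf (evalᶜ s (cons n (cons v xs))) K
↦-resume-prec s n xs v K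
  rewrite ↦-return v 3 (pair s (pair n xs)) K | unpair₁-pair s (pair n xs) | unpair₂-pair s (pair n xs)
        | unpair₁-pair n xs | unpair₂-pair n xs = refl

↦-resume-mu : ∀ f xs z v K → conf (returnᶜ v) (cons (muᶠ f xs z) K) ↦ muStep f xs z v K
↦-resume-mu f xs z v K
  rewrite ↦-return v 4 (pair f (pair xs z)) K | unpair₁-pair f (pair xs z) | unpair₂-pair f (pair xs z)
        | unpair₁-pair xs z | unpair₂-pair xs z = refl

↦-cz : ∀ {k} xs K → conf (evalᶜ (encode (cz {k})) xs) K ↦ conf (returnᶜ 0) K
↦-cz xs K = ↦-eval 0 0 xs K

↦-sc : ∀ x l K → conf (evalᶜ (encode sc) (cons x l)) K ↦ conf (returnᶜ (suc x)) K
↦-sc x l K rewrite ↦-eval 1 0 (cons x l) K | hd-cons x l = refl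

↦-proj : ∀ {k} (i : Fin k) xs K → conf (evalᶜ (encode (proj i)) (encodeArgs xs)) K ↦ conf (returnᶜ (lookup xs i)) K
↦-proj i xs K rewrite ↦-eval 2 (toℕ i) (encodeArgs xs) K | nth-encodeArgs xs i = refl

↦-comp : ∀ {k m} (f : PR m) (gs : Vec (PR k) m) xs K →
         conf (evalᶜ (encode (comp f gs)) xs) K ↦ conf (evalAllᶜ (encodeAll gs) xs) (cons (composeᶠ (encode f)) K)
↦-comp f gs xs K
  rewrite ↦-eval 3 (pair (encode f) (encodeAll gs)) xs K
        | unpair₁-pair (encode f) (encodeAll gs) | unpair₂-pair (encode f) (encodeAll gs) = refl

↦-prec-zero : ∀ {k} (b : PR k) s xs K → conf (evalᶜ (encode (prec b s)) (cons 0 xs)) K ↦ conf (evalᶜ (encode b) xs) K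
↦-prec-zero b s xs K
  rewrite ↦-eval 4 (pair (encode b) (encode s)) (cons 0 xs) K
        | unpair₁-pair (encode b) (encode s) | hd-cons 0 xs | tl-cons 0 xs = refl

↦-prec-suc : ∀ {k} (b : PR k) s n xs K →
             conf (evalᶜ (encode (prec b s)) (cons (suc n) xs)) K
               ↦ conf (evalᶜ (encode (prec b s)) (cons n xs)) (cons (precᶠ (encode s) n xs) K)
↦-prec-suc b s n xs K
  rewrite ↦-eval 4 (pair (encode b) (encode s)) (cons (suc n) xs) K
        | unpair₂-pair (encode b) (encode s) | hd-cons (suc n) xs | tl-cons (suc n) xs = refl

↦-mu : ∀ {k} (f : PR (suc k)) xs K →
       conf (evalᶜ (encode (mu f)) xs) K ↦ conf (evalᶜ (encode f) (cons 0 xs)) (cons (muᶠ (encode f) xs 0) K)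
↦-mu f xs K = ↦-eval 5 (encode f) xs K

↦-evalAll-[] : ∀ xs K → conf (evalAllᶜ 0 xs) K ↦ conf (returnᶜ 0) K
↦-evalAll-[] = ↦-evalAll 0

↦-evalAll-∷ : ∀ g gs xs K → conf (evalAllᶜ (cons g gs) xs) K ↦ conf (evalᶜ g xs) (cons (restᶠ gs xs) K)
↦-evalAll-∷ g gs xs K rewrite ↦-evalAll (cons g gs) xs K | hd-cons g gs | tl-cons g gs = refl

mutual
  eval⇒↦* : ∀ {k} {c : PR k} {xs y} → Eval c xs y →
            ∀ K → conf (evalᶜ (encode c) (encodeArgs xs)) K ↦* conf (returnᶜ y) K
  eval⇒↦* {k} ev-cz K = ↦-cz {k} _ K ◅ ε
  eval⇒↦* (ev-sc {x}) K = ↦-sc x 0 K ◅ ε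
  eval⇒↦* {c = proj i} {xs} ev-proj K = ↦-proj i xs K ◅ ε
  eval⇒↦* {c = comp f gs} {xs} (ev-comp {ys = ys} evs ev) K =
    ↦-comp f gs _ K
    ◅ evalAll⇒↦* evs (cons (composeᶠ (encode f)) K)
    ◅◅ ↦-resume-compose (encode f) (encodeArgs ys) K
    ◅ eval⇒↦* ev K
  eval⇒↦* {c = prec b s} (ev-prec0 ev) K = ↦-prec-zero b s _ K ◅ eval⇒↦* ev K
  eval⇒↦* {c = prec b s} (ev-precS {n = n} {xs = xs} {y = y} evₙ ev) K =
    ↦-prec-suc b s n _ K
    ◅ eval⇒↦* evₙ (cons (precᶠ (encode s) n (encodeArgs xs)) K)
    ◅◅ ↦-resume-prec (encode s) n (encodeArgs xs) y K
    ◅ eval⇒↦* ev K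
  eval⇒↦* {c = mu f} {xs} {y} (ev-mu ev₀ ev<) K = ↦-mu f _ K ◅ search 0 y refl
    where
    search : ∀ z d → z + d ≡ y →
             conf (evalᶜ (encode f) (cons z (encodeArgs xs))) (cons (muᶠ (encode f) (encodeArgs xs) z) K)
               ↦* conf (returnᶜ y) K
    search z zero z+0≡y with trans (sym (+-identityʳ z)) z+0≡y
    ... | refl = eval⇒↦* ev₀ _ ◅◅ ↦-resume-mu _ _ z 0 K ◅ ε
    search z (suc d) z+d≡y with ev< z (subst (z <_) z+d≡y (m<m+n z z<s))
    ... | m , evₘ =
      eval⇒↦* evₘ _ ◅◅ ↦-resume-mu _ _ z (suc m) K ◅ search (suc z) d (trans (sym (+-suc z d)) z+d≡y)

  evalAll⇒↦* : ∀ {k m} {gs : Vec (PR k) m} {xs ys} → EvalAll gs xs ys →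
               ∀ K → conf (evalAllᶜ (encodeAll gs) (encodeArgs xs)) K ↦* conf (returnᶜ (encodeArgs ys)) K
  evalAll⇒↦* ev-[] K = ↦-evalAll-[] _ K ◅ ε
  evalAll⇒↦* {gs = g ∷ gs} {xs} (ev-∷ {y = y} {ys = ys} ev evs) K =
    ↦-evalAll-∷ (encode g) (encodeAll gs) _ K
    ◅ eval⇒↦* ev (cons (restᶠ (encodeAll gs) (encodeArgs xs)) K)
    ◅◅ ↦-resume-rest (encodeAll gs) (encodeArgs xs) y K
    ◅ evalAll⇒↦* evs (cons (prependᶠ y) K)
    ◅◅ ↦-resume-prepend y (encodeArgs ys) K
    ◅ ε

steps : ℕ → ℕ → ℕ
steps zero    st = st
steps (suc n) st = step (steps n st)

steps-computable : Computable₂ steps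
steps-computable = recursion₂ arg₀ (app₁ step-computable arg₁) (λ _ → refl) (λ _ _ → refl)

steps-+ : ∀ m n st → steps (m + n) st ≡ steps m (steps n st)
steps-+ zero    n st = refl
steps-+ (suc m) n st = cong step (steps-+ m n st)

steps-suc : ∀ n st → steps (suc n) st ≡ steps n (step st)
steps-suc zero    st = refl
steps-suc (suc n) st = cong step (steps-suc n st)

↦*⇒steps : ∀ {a b} → a ↦* b → ∃ λ n → steps n a ≡ b
↦*⇒steps ε = 0 , refl
↦*⇒steps {a} (a↦a′ ◅ a′↦*b) with ↦*⇒steps a′↦*b
... | n , eq = suc n , trans (steps-suc n a) (trans (cong (steps n) a↦a′) eq)

steps-fixed : ∀ {st} → step st ≡ st → ∀ n → steps n st ≡ st
steps-fixed fixed zero    = refl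
steps-fixed fixed (suc n) = trans (cong step (steps-fixed fixed n)) fixed

start : ℕ → ℕ → ℕ
start e a = conf (evalᶜ e a) 0

final : ℕ → ℕ
final y = conf (returnᶜ y) 0

result : ℕ → ℕ
result st = unpair₂ (unpair₁ st)

result-final : ∀ y → result (final y) ≡ y
result-final y rewrite unpair₁-pair (returnᶜ y) 0 = unpair₂-pair 2 y

-- suc y: the configuration has halted with output y; 0: it has not halted.
haltedValue : ℕ → ℕ
haltedValue st = ifZero ∣ step st - st ∣ (suc (result st)) 0

haltedValue-final : ∀ y → haltedValue (final y) ≡ suc y
haltedValue-final y rewrite halted y | ∣n-n∣≡0 (final y) = cong suc (result-final y)

haltedValue-cases : ∀ st → haltedValue st ≡ 0 ⊎ (step st ≡ st × haltedValue st ≡ suc (result st))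
haltedValue-cases st with ∣ step st - st ∣ in eq
... | zero  = inj₂ (∣m-n∣≡0⇒m≡n eq , refl)
... | suc _ = inj₁ refl

abstract
  runFor : ℕ → ℕ → ℕ → ℕ
  runFor e a s = haltedValue (steps s (start e a))

  runFor-computable : Computable₃ runFor
  runFor-computable = computable₃ runForFn (λ _ _ _ → refl)
    where
    open Machine (computable-ops {3}) using () renaming (conf to confFn; evalᶜ to evalFn)
    stFn : ComputableFn 3
    stFn = app₂ steps-computable arg₂ (confFn (evalFn arg₀ arg₁) (const 0))
    runForFn : ComputableFn 3
    runForFn = app₃ ifZero-computable (app₂ ∣-∣-computable (app₁ step-computable stFn) stFn)
                 (app₁ suc-computable (app₁ unpair₂-computable (app₁ unpair₁-computable stFn))) (const 0)

  runFor-≡ : ∀ e a s → runFor e a s ≡ haltedValue (steps s (start e a))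
  runFor-≡ e a s = refl

module _ {k} {c : PR k} {xs y} (ev : Eval c xs y) where

  private
    run : ℕ → ℕ
    run s = steps s (start (encode c) (encodeArgs xs))

    halting-time : ∃ λ N → run N ≡ final y
    halting-time = ↦*⇒steps (eval⇒↦* ev 0)

    N : ℕ
    N = proj₁ halting-time

    run-halted : ∀ s → N ≤ s → run s ≡ final y
    run-halted s N≤s = begin
      run s                                          ≡⟨ cong (λ m → steps m _) (sym (m∸n+n≡m N≤s)) ⟩
      steps (s ∸ N + N) (start _ _)                  ≡⟨ steps-+ (s ∸ N) N _ ⟩
      steps (s ∸ N) (run N)                          ≡⟨ cong (steps (s ∸ N)) (proj₂ halting-time) ⟩
      steps (s ∸ N) (final y)                        ≡⟨ steps-fixed (halted y) (s ∸ N) ⟩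
      final y                                        ∎
      where open ≡-Reasoning

    fixed⇒final : ∀ s → step (run s) ≡ run s → run s ≡ final y
    fixed⇒final s fixed = begin
      run s                ≡⟨ sym (steps-fixed fixed N) ⟩
      steps N (run s)      ≡⟨ sym (steps-+ N s _) ⟩
      run (N + s)          ≡⟨ run-halted (N + s) (m≤m+n N s) ⟩
      final y              ∎
      where open ≡-Reasoning

  runFor-converges : ∃ λ N → ∀ s → N ≤ s → runFor (encode c) (encodeArgs xs) s ≡ suc y
  runFor-converges =
    N , λ s N≤s → trans (runFor-≡ _ _ s) (trans (cong haltedValue (run-halted s N≤s)) (haltedValue-final y))

  runFor-sound : ∀ s → runFor (encode c) (encodeArgs xs) s ≡ 0 ⊎ runFor (encode c) (encodeArgs xs) s ≡ suc y
  runFor-sound s with haltedValue-cases (run s)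
  ... | inj₁ idle          = inj₁ (trans (runFor-≡ _ _ s) idle)
  ... | inj₂ (fixed , val) =
    inj₂ (trans (runFor-≡ _ _ s) (trans val (cong suc (trans (cong result (fixed⇒final s fixed)) (result-final y)))))

lookup-injective : ∀ {A : Set} {l : List A} → Unique l → ∀ i j → List.lookup l i ≡ List.lookup l j → i ≡ j
lookup-injective (_ ∷ _)  zero    zero    _  = refl
lookup-injective (∉ ∷ _)  zero    (suc j) eq = contradiction eq (All.lookup ∉ (∈-lookup j))
lookup-injective (∉ ∷ _)  (suc i) zero    eq = contradiction (sym eq) (All.lookup ∉ (∈-lookup i))
lookup-injective (_ ∷ un) (suc i) (suc j) eq = cong suc (lookup-injective un i j eq)

ChangeAt : (ℕ → ℕ) → ℕ → Set
ChangeAt f s = f s ≢ f (suc s)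

change-between : ∀ f {a b} → a ≤ b → f a ≢ f b → ∃ λ c → a ≤ c × c < b × ChangeAt f c
change-between f {b = zero}  z≤n fa≢fb = contradiction refl fa≢fb
change-between f {a} {suc b} a≤1+b fa≢fb with m≤n⇒m<n∨m≡n a≤1+b
... | inj₂ refl = contradiction refl fa≢fb
... | inj₁ a<1+b with f b ≟ f (suc b)
...   | no  change = b , s≤s⁻¹ a<1+b , ≤-refl , change
...   | yes fb≡fb+1 with change-between f (s≤s⁻¹ a<1+b) (λ fa≡fb → fa≢fb (trans fa≡fb fb≡fb+1))
...     | c , a≤c , c<b , change = c , a≤c , m≤n⇒m≤1+n c<b , change

Nonincreasing : (ℕ → ℕ) → Set
Nonincreasing f = ∀ s → f (suc s) ≤ f s

module _ {f : ℕ → ℕ} (f↓ : Nonincreasing f) where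

  nonincreasing-antitone : ∀ {a b} → a ≤ b → f b ≤ f a
  nonincreasing-antitone {b = zero}  z≤n   = ≤-refl
  nonincreasing-antitone {b = suc b} a≤1+b with m≤n⇒m<n∨m≡n a≤1+b
  ... | inj₁ a<1+b = ≤-trans (f↓ b) (nonincreasing-antitone (s≤s⁻¹ a<1+b))
  ... | inj₂ refl  = ≤-refl

  change-drops : ∀ {s} → ChangeAt f s → f (suc s) < f s
  change-drops {s} change = ≤∧≢⇒< (f↓ s) (≢-sym change)

  change-below-start : ∀ {s} → ChangeAt f s → f (suc s) < f 0
  change-below-start change = <-≤-trans (change-drops change) (nonincreasing-antitone z≤n)

  change-injective : ∀ {a b} → ChangeAt f a → ChangeAt f b → f (suc a) ≡ f (suc b) → a ≡ b
  change-injective {a} {b} change-a change-b eq with <-cmp a b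
  ... | tri< a<b _ _ = contradiction (<-≤-trans (change-drops change-b) (nonincreasing-antitone a<b)) (<-irrefl (sym eq))
  ... | tri≈ _ a≡b _ = a≡b
  ... | tri> _ _ b<a = contradiction (<-≤-trans (change-drops change-a) (nonincreasing-antitone b<a)) (<-irrefl eq)

  -- Distinct change points have distinct values f (suc s) < f 0, so pigeonhole applies.
  changes-bounded : ∀ {l} → Unique l → All (ChangeAt f) l → length l ≤ f 0
  changes-bounded {l} distinct changes with length l ≤? f 0
  ... | yes bounded = bounded
  ... | no unbounded =
    let i , j , i<j , eq = Fin.pigeonhole (≰⇒> unbounded) value in
    contradiction (lookup-injective distinct i j (change-injective (change i) (change j) (value-injective eq))) (Fin.<⇒≢ i<j)
    where
    change : ∀ i → ChangeAt f (List.lookup l i)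
    change i = All.lookup changes (∈-lookup i)
    value : Fin (length l) → Fin (f 0)
    value i = fromℕ< (change-below-start (change i))
    value-injective : ∀ {i j} → value i ≡ value j → f (suc (List.lookup l i)) ≡ f (suc (List.lookup l j))
    value-injective {i} {j} eq =
      trans (sym (Fin.toℕ-fromℕ< (change-below-start (change i))))
            (trans (cong toℕ eq) (Fin.toℕ-fromℕ< (change-below-start (change j))))

  nonincreasing-stabilizes : ¬ ¬ ∃ λ s₀ → ∀ s → s₀ ≤ s → f s ≡ f s₀
  nonincreasing-stabilizes unstable = below (f 0) 0 ≤-refl
    where
    below : ∀ w a → f a ≤ w → ⊥
    below zero    a fa≤0   = unstable (a , λ s a≤s → ≤-antisym (nonincreasing-antitone a≤s) (≤-trans fa≤0 z≤n))
    below (suc w) a fa≤1+w = unstable (a , stable)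
      where
      stable : ∀ s → a ≤ s → f s ≡ f a
      stable s a≤s with f s ≟ f a
      ... | yes fs≡fa = fs≡fa
      ... | no  fs≢fa =
        ⊥-elim (below w s (s≤s⁻¹ (≤-trans (≤∧≢⇒< (nonincreasing-antitone a≤s) fs≢fa) fa≤1+w)))

update : ℕ → ℕ → ℕ
update v r = ifZero ∣ r - suc v ∣ (pred v) v

update-≤ : ∀ v r → update v r ≤ v
update-≤ v r with ∣ r - suc v ∣
... | zero  = pred[n]≤n
... | suc _ = ≤-refl

update-hit : ∀ v → update v (suc v) ≡ pred v
update-hit v rewrite ∣n-n∣≡0 v = refl

update-miss : ∀ {v y} → y ≢ v → update v (suc y) ≡ v
update-miss {v} {y} y≢v with ∣ y - v ∣ in eq
... | zero  = contradiction (∣m-n∣≡0⇒m≡n eq) y≢v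
... | suc _ = refl

-- The state is ⟨guess , number of inputs read⟩; r is the outcome of probing the next input.
next : ℕ → ℕ → ℕ
next G r = ifZero r G (pair (update (unpair₁ G) r) (suc (unpair₂ G)))

probe : ℕ → ℕ → ℕ → ℕ
probe x t s = runFor (unpair₁ x) (encodeArgs (x ∷ t ∷ [])) s

diagState : ℕ → ℕ → ℕ
diagState x zero    = pair (suc (unpair₂ x)) 0
diagState x (suc s) = let G = diagState x s in next G (probe x (unpair₂ G) s)

approx : ℕ → ℕ → ℕ
approx x s = unpair₁ (diagState x s)

approx-computable : Computable₂ approx
approx-computable = computable₂ (app₁ unpair₁-computable (app₂ state-computable arg₁ arg₀)) (λ _ _ → refl)
  where
  open Machine (computable-ops {3}) using () renaming (cons to consFn)
  unpair₁Fn unpair₂Fn : ComputableFn 3 → ComputableFn 3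
  unpair₁Fn = app₁ unpair₁-computable
  unpair₂Fn = app₁ unpair₂-computable
  -- arguments: stage s, state G, input x
  probeFn : ComputableFn 3
  probeFn = app₃ runFor-computable (unpair₁Fn arg₂) (consFn arg₂ (consFn (unpair₂Fn arg₁) (const 0))) arg₀
  nextFn : ComputableFn 3
  nextFn = app₃ ifZero-computable probeFn arg₁
             (app₂ pair-computable
               (app₃ ifZero-computable (app₂ ∣-∣-computable probeFn (app₁ suc-computable (unpair₁Fn arg₁)))
                 (app₁ pred-computable (unpair₁Fn arg₁)) (unpair₁Fn arg₁))
               (app₁ suc-computable (unpair₂Fn arg₁)))
  state-computable : Computable₂ (λ s x → diagState x s)
  state-computable =
    recursion₂ (app₂ pair-computable (app₁ suc-computable (app₁ unpair₂-computable arg₀)) (const 0)) nextFn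
      (λ _ → refl) (λ _ _ → refl)

next-≤ : ∀ G r → unpair₁ (next G r) ≤ unpair₁ G
next-≤ G zero    = ≤-refl
next-≤ G (suc y) rewrite unpair₁-pair (update (unpair₁ G) (suc y)) (suc (unpair₂ G)) = update-≤ (unpair₁ G) (suc y)

approx-nonincreasing : ∀ x → Nonincreasing (approx x)
approx-nonincreasing x s = next-≤ (diagState x s) _

approx-changes : ∀ x → ChangesAtMost approx x (suc x)
approx-changes x changes distinct areChanges =
  ≤-trans (changes-bounded (approx-nonincreasing x) distinct areChanges)
          (subst (_≤ suc x) (sym (unpair₁-pair (suc (unpair₂ x)) 0)) (s≤s (unpair₂-≤ x)))

module Diagonal (c : PR 2) (g : ℕ → ℕ → ℕ) (c-computes : ∀ x t → Eval c (x ∷ t ∷ []) (g x t)) (n : ℕ) where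

  x : ℕ
  x = pair (encode c) n

  state : ℕ → ℕ
  state = diagState x

  guess tested : ℕ → ℕ
  guess s  = unpair₁ (state s)
  tested s = unpair₂ (state s)

  probe-≡ : ∀ t s → probe x t s ≡ runFor (encode c) (encodeArgs (x ∷ t ∷ [])) s
  probe-≡ t s = cong (λ e → runFor e (encodeArgs (x ∷ t ∷ [])) s) (unpair₁-pair (encode c) n)

  probe-converges : ∀ t → ∃ λ N → ∀ s → N ≤ s → probe x t s ≡ suc (g x t)
  probe-converges t with runFor-converges (c-computes x t)
  ... | N , converges = N , λ s N≤s → trans (probe-≡ t s) (converges s N≤s)

  probe-sound : ∀ t s → probe x t s ≡ 0 ⊎ probe x t s ≡ suc (g x t)
  probe-sound t s with runFor-sound (c-computes x t) s
  ... | inj₁ idle = inj₁ (trans (probe-≡ t s) idle)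
  ... | inj₂ read = inj₂ (trans (probe-≡ t s) read)

  Reads : ℕ → Set
  Reads s = probe x (tested s) s ≡ suc (g x (tested s))

  state-idle : ∀ {s} → probe x (tested s) s ≡ 0 → state (suc s) ≡ state s
  state-idle {s} idle = cong (next (state s)) idle

  state-reads : ∀ {s} → Reads s →
            guess (suc s) ≡ update (guess s) (suc (g x (tested s))) × tested (suc s) ≡ suc (tested s)
  state-reads {s} reads rewrite reads = unpair₁-pair _ _ , unpair₂-pair _ _

  next-read : ∀ a → ∃ λ s → a ≤ s × state s ≡ state a × Reads s
  next-read a with probe-converges (tested a)
  ... | N , converges with scan N
    where
    scan : ∀ d → (∃ λ s → a ≤ s × state s ≡ state a × Reads s) ⊎ state (a + d) ≡ state a
    scan zero = inj₂ (cong state (+-identityʳ a))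
    scan (suc d) with scan d
    ... | inj₁ found = inj₁ found
    ... | inj₂ unchanged with probe-sound (tested (a + d)) (a + d)
    ...   | inj₂ reads = inj₁ (a + d , m≤m+n a d , unchanged , reads)
    ...   | inj₁ idle  = inj₂ (trans (cong state (+-suc a d)) (trans (state-idle idle) unchanged))
  ... | inj₁ found     = found
  ... | inj₂ unchanged = a + N , m≤m+n a N , unchanged , reads
    where
    same : tested (a + N) ≡ tested a
    same = cong unpair₂ unchanged
    reads : Reads (a + N)
    reads rewrite same = converges (a + N) (m≤n+m N a)

  reads-beyond : ∀ a k → ∃ λ s → a ≤ s × Reads s × k ≤ tested s
  reads-beyond a zero with next-read a
  ... | s , a≤s , _ , reads = s , a≤s , reads , z≤n
  reads-beyond a (suc k) with reads-beyond a k
  ... | s , a≤s , reads , k≤t with next-read (suc s)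
  ...   | s′ , s<s′ , unchanged , reads′ =
    s′ , ≤-trans a≤s (<⇒≤ s<s′) , reads′ ,
    subst (suc k ≤_) (sym (trans (cong unpair₂ unchanged) (proj₂ (state-reads reads)))) (s≤s k≤t)

  record Witness (v : ℕ) : Set where
    field
      changes      : List ℕ
      distinct     : Unique changes
      areChanges   : All (ChangeAt (g x)) changes
      count        : length changes + v ≡ n
      last         : ℕ
      g-last       : g x last ≡ suc v
      changes<last : All (_< last) changes

  -- Each decrement of the guess from n + 1 down to v is paid for by a change of g x
  -- before the input last, at which g x takes the value v + 1.
  Invariant : ℕ → ℕ → Set
  Invariant v t = v ≡ suc n ⊎ Σ (Witness v) λ w → Witness.last w < t

  fresh : ∀ {v c} (w : Witness v) → Witness.last w ≤ c → All (c ≢_) (Witness.changes w)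
  fresh w last≤c = All.map (λ s<last → ≢-sym (<⇒≢ (<-≤-trans s<last last≤c))) (Witness.changes<last w)

  invariant-weaken : ∀ {v t t′} → t ≤ t′ → Invariant v t → Invariant v t′
  invariant-weaken t≤t′ (inj₁ start)          = inj₁ start
  invariant-weaken t≤t′ (inj₂ (w , last<t)) = inj₂ (w , <-≤-trans last<t t≤t′)

  invariant-hit : ∀ {v t} → g x t ≡ v → Invariant v t → Invariant (pred v) (suc t)
  invariant-hit {zero}      g-t inv = invariant-weaken (n≤1+n _) inv
  invariant-hit {suc w} {t} g-t (inj₁ refl) = inj₂ (record
    { changes = [] ; distinct = [] ; areChanges = [] ; count = refl
    ; last = t ; g-last = g-t ; changes<last = [] } , ≤-refl)
  invariant-hit {suc w} {t} g-t (inj₂ (old , last<t)) with change-between (g x) (<⇒≤ last<t) g-last≢g-t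
    where
    open Witness old
    g-last≢g-t : g x last ≢ g x t
    g-last≢g-t eq = 1+n≢n (suc-injective (trans (sym g-last) (trans eq g-t)))
  ... | c , last≤c , c<t , change = inj₂ (record
    { changes = c ∷ changes
    ; distinct = fresh old last≤c ∷ distinct
    ; areChanges = change ∷ areChanges
    ; count = trans (sym (+-suc (length changes) w)) count
    ; last = t ; g-last = g-t
    ; changes<last = c<t ∷ All.map (λ s<last → <-trans s<last (≤-<-trans last≤c c<t)) changes<last } , ≤-refl)
    where open Witness old

  invariant-read : ∀ {v t} → Invariant v t → Invariant (update v (suc (g x t))) (suc t)
  invariant-read {v} {t} inv with g x t ≟ v
  ... | no  g-t≢v = subst (λ v′ → Invariant v′ (suc t)) (sym (update-miss g-t≢v)) (invariant-weaken (n≤1+n t) inv)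
  ... | yes g-t≡v =
    subst (λ v′ → Invariant v′ (suc t)) (sym (trans (cong (λ y → update v (suc y)) g-t≡v) (update-hit v)))
          (invariant-hit g-t≡v inv)

  invariant : ∀ s → Invariant (guess s) (tested s)
  invariant zero = inj₁ (trans (unpair₁-pair _ 0) (cong suc (unpair₂-pair (encode c) n)))
  invariant (suc s) with probe-sound (tested s) s
  ... | inj₁ idle  = subst (λ st → Invariant (unpair₁ st) (unpair₂ st)) (sym (state-idle idle)) (invariant s)
  ... | inj₂ reads with state-reads reads
  ...   | guess≡ , tested≡ rewrite guess≡ | tested≡ = invariant-read (invariant s)

  limit-differs : ∀ w → ChangesAtMost g x n → Lim approx x w → Lim g x w → ⊥
  limit-differs zero at-most-n (s₀ , stable) (s₁ , g-stable) with invariant s₀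
  ... | inj₁ start = 0≢1+n (trans (sym (stable s₀ ≤-refl)) start)
  ... | inj₂ (w , _) with change-between (g x) (m≤m+n last s₁) g-last≢g-later
    where
    open Witness w
    g-last≢g-later : g x last ≢ g x (last + s₁)
    g-last≢g-later eq = 0≢1+n (trans (sym (g-stable (last + s₁) (m≤n+m s₁ last)))
                                    (trans (sym eq) (trans g-last (cong suc (stable s₀ ≤-refl)))))
  ...   | c , last≤c , _ , change =
    <-irrefl all-changes (at-most-n (c ∷ changes) (fresh w last≤c ∷ distinct) (change ∷ areChanges))
    where
    open Witness w
    all-changes : length changes ≡ n
    all-changes = trans (sym (+-identityʳ _)) (trans (cong (length changes +_) (sym (stable s₀ ≤-refl))) count)
  limit-differs (suc w) _ (s₀ , stable) (s₁ , g-stable) with reads-beyond s₀ s₁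
  ... | s , s₀≤s , reads , s₁≤t = 1+n≢n (trans (sym (stable (suc s) (m≤n⇒m≤1+n s₀≤s))) decremented)
    where
    hit : g x (tested s) ≡ guess s
    hit = trans (g-stable (tested s) s₁≤t) (sym (stable s s₀≤s))
    decremented : guess (suc s) ≡ w
    decremented = begin
      guess (suc s)                               ≡⟨ proj₁ (state-reads reads) ⟩
      update (guess s) (suc (g x (tested s)))     ≡⟨ cong (λ y → update (guess s) (suc y)) hit ⟩
      update (guess s) (suc (guess s))            ≡⟨ update-hit (guess s) ⟩
      pred (guess s)                              ≡⟨ cong pred (stable s s₀≤s) ⟩
      w                                           ∎
      where open ≡-Reasoning

corollary3p10 : Σ (ℕ → ℕ → ℕ) λ g → OmegaApproxAboveWitness g × ((n : ℕ) → ¬ LimitIsNApprox g n)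
corollary3p10 =
  approx , (approx-computable , approx-nonincreasing , suc , suc-computable , approx-changes) , not-approximable
  where
  not-approximable : (n : ℕ) → ¬ LimitIsNApprox approx n
  not-approximable n (g , (c , c-computes) , g-changes , same-limit) =
    nonincreasing-stabilizes (approx-nonincreasing x) λ (s₀ , stable) →
      limit-differs _ (g-changes x) (s₀ , stable) (same-limit x _ (s₀ , stable))
    where
    open Diagonal c g c-computes n
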